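{- For each integer $k \geq 2$ there exists an $\varepsilon > 0$ such that for all integers $n$ and $c$ there exists a digraph $D$ with $|V(D)| \geq n$, $\chi(D) \geq c$, and minimum out-degree at least $\varepsilon |V(D)|$, such that $D$ does not contain a directed $k$-cycle as a subdigraph.
   Context: Digraphs have no loops and no parallel arcs (anti-parallel arcs allowed); $\chi(D)$ is the chromatic number of the underlying undirected graph; subdigraphs need not be induced. -}

module Defs where

open import Data.Nat using (ℕ; zero; suc; _<_)
open import Data.Bool using (Bool; true; false; T)
open import Data.Fin using (Fin; toℕ)
open import Data.List using (List; length; filterᵇ; allFin)
open import Data.Product using (Σ; _×_)
open import Data.Sum using (_⊎_)
open import Relation.Binary.PropositionalEquality using (_≡_; _≢_)
open import Relation.Nullary using (¬_)
open import Function.Definitions using (Injective)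

-- A digraph on vertex set Fin m: a decidable arc relation with no loops.
-- (A relation admits no parallel arcs; anti-parallel arcs are allowed.)
record Digraph (m : ℕ) : Set where
  field
    arc     : Fin m → Fin m → Bool
    loopless : ∀ v → arc v v ≡ false
open Digraph public

Arc : ∀ {m} → Digraph m → Fin m → Fin m → Set
Arc D u v = T (arc D u v)

outdeg : ∀ {m} → Digraph m → Fin m → ℕ
outdeg {m} D v = length (filterᵇ (arc D v) (allFin m))

ProperColouring : ∀ {m} → Digraph m → (d : ℕ) → (Fin m → Fin d) → Set
ProperColouring D d f = ∀ u v → Arc D u v → f u ≢ f v

ChromaticAtLeast : ∀ {m} → Digraph m → ℕ → Set
ChromaticAtLeast {m} D c = ∀ d → d < c → ¬ (Σ (Fin m → Fin d) (ProperColouring D d))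

CycSucc : ∀ {k} → Fin k → Fin k → Set
CycSucc {k} i j = toℕ j ≡ suc (toℕ i) ⊎ (toℕ j ≡ 0 × suc (toℕ i) ≡ k)

HasDirectedCycle : ∀ {m} → ℕ → Digraph m → Set
HasDirectedCycle {m} k D =
  Σ (Fin k → Fin m) λ v → Injective _≡_ _≡_ v × (∀ i j → CycSucc i j → Arc D (v i) (v j))

{-# OPTIONS --safe #-}
-- The digraph has two layers. The first is the shift graph on pairs (i , j) of
-- Fin N, with arcs (i , j) → (j , l) for i < j < l; it has no directed cycle, and
-- every colouring with d colours, 2 ^ d < N, has a monochromatic arc, since two
-- indices i < i′ with the same set of colours {f (i , j) | i < j} give an arc
-- (i , i′) → (i′ , l) with f (i′ , l) = f (i , i′). The second is the blow-up of
-- a directed (k + 1)-cycle with parts of size N², in which the length of every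
-- closed walk is a multiple of k + 1. Each shift-graph vertex also sends arcs to
-- a whole part, and no arc leads back, so a directed k-cycle would lie inside
-- one layer, which is impossible. Every vertex has out-degree at least N², a
-- fraction 1 / (k + 2) of all vertices.
module Submission where

open import Defs
open import Data.Nat using (ℕ; _≥_)
open import Data.Integer using (+_)
open import Data.Rational using (ℚ; 0ℚ; _<_; _≤_; _*_; _/_)
open import Data.Product using (Σ; _×_)
open import Relation.Nullary using (¬_)

open import Data.Bool using (Bool; T)
open import Data.Bool.Properties using (T-not-≡)
open import Data.Empty using (⊥; ⊥-elim)
open import Data.Fin as Fin using (Fin; zero; suc; toℕ; fromℕ; inject₁; lower₁; funToFin; finToFun)
import Data.Fin.Properties as Fin
open import Data.Fin.Induction using (<-weakInduction; <-weakInduction-startingFrom)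
import Data.Integer as ℤ
import Data.Integer.Properties as ℤ
open import Data.List using (List; length; filterᵇ; allFin; lookup)
open import Data.List.Membership.Propositional using (_∈_)
open import Data.List.Membership.Propositional.Properties using (∈-filter⁺; ∈-allFin)
open import Data.List.Relation.Unary.Any using (index)
open import Data.List.Relation.Unary.Any.Properties using (lookup-index)
open import Data.Nat as ℕ using (zero; suc; _^_)
import Data.Nat.Properties as ℕ
import Data.Nat.Coprimality as Coprime
open import Data.Nat.Divisibility using (_∣_; divides; _∣0; ∣⇒≤)
open import Data.Product using (∃; ∃₂; _,_; uncurry)
open import Data.Product.Properties using (,-injectiveʳ)
open import Data.Rational using (mkℚ; toℚᵘ)
open import Data.Rational.Properties using (normalize-coprime; toℚᵘ-cancel-≤; toℚᵘ-homo-*; positive⁻¹)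
open import Data.Rational.Unnormalised as ℚᵘ using (↥_; ↧_)
import Data.Rational.Unnormalised.Properties as ℚᵘ
open import Data.Sum using (_⊎_; inj₁; inj₂)
open import Data.Sum.Properties using (inj₂-injective)
open import Data.Sum.Function.Propositional using (_⊎-↔_)
open import Data.Unit using (⊤; tt)
open import Function using (_∘_; _↔_; Inverse; Equivalence)
open import Function.Definitions using (Injective)
open import Function.Properties.Inverse using (↔-trans)
open import Relation.Binary.Definitions using (Decidable)
open import Relation.Binary.PropositionalEquality
open import Relation.Nullary using (Dec; yes; no)
open import Relation.Nullary.Decidable
  using (isYes; T?; toWitness; fromWitness; fromWitnessFalse; map′; _×-dec_; _⊎-dec_)

injective⇒≤-length-filterᵇ : ∀ {m t} (p : Fin m → Bool) (g : Fin t → Fin m) →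
  Injective _≡_ _≡_ g → (∀ x → T (p (g x))) → t ℕ.≤ length (filterᵇ p (allFin m))
injective⇒≤-length-filterᵇ {m} {t} p g g-injective p∘g = Fin.injective⇒≤ position-injective
  where
  xs : List (Fin m)
  xs = filterᵇ p (allFin m)
  g∈xs : ∀ x → g x ∈ xs
  g∈xs x = ∈-filter⁺ (T? ∘ p) (∈-allFin (g x)) (p∘g x)
  position : Fin t → Fin (length xs)
  position x = index (g∈xs x)
  position-injective : Injective _≡_ _≡_ position
  position-injective {x} {y} same = g-injective (begin
    g x                     ≡⟨ lookup-index (g∈xs x) ⟩
    lookup xs (position x)  ≡⟨ cong (lookup xs) same ⟩
    lookup xs (position y)  ≡⟨ lookup-index (g∈xs y) ⟨
    g y                     ∎)
    where open ≡-Reasoning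

CycSucc? : ∀ {p} → Decidable (CycSucc {p})
CycSucc? {p} i j = toℕ j ℕ.≟ suc (toℕ i) ⊎-dec (toℕ j ℕ.≟ 0 ×-dec suc (toℕ i) ℕ.≟ p)

CycSucc-irrefl : ∀ {n} (i : Fin (suc (suc n))) → ¬ CycSucc i i
CycSucc-irrefl i (inj₁ i≡1+i) = ℕ.1+n≢n (sym i≡1+i)
CycSucc-irrefl i (inj₂ (i≡0 , 1+i≡2+n)) =
  ℕ.0≢1+n (ℕ.suc-injective (trans (cong suc (sym i≡0)) 1+i≡2+n))

cyclicSuccessor : ∀ {n} (i : Fin (suc n)) → ∃ (CycSucc i)
cyclicSuccessor {n} i with n ℕ.≟ toℕ i
... | yes n≡i = zero , inj₂ (refl , cong suc (sym n≡i))
... | no n≢i = suc (lower₁ i n≢i) , inj₁ (cong suc (Fin.toℕ-lower₁ i n≢i))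

CycSucc-inject₁-suc : ∀ {n} (i : Fin n) → CycSucc (inject₁ i) (suc i)
CycSucc-inject₁-suc i = inj₁ (cong suc (sym (Fin.toℕ-inject₁ i)))

CycSucc-fromℕ-zero : ∀ n → CycSucc (fromℕ n) zero
CycSucc-fromℕ-zero n = inj₂ (refl , cong suc (Fin.toℕ-fromℕ n))

CycSucc-unwrap : ∀ {p} {i j : Fin p} → CycSucc i j → ∃ λ t → toℕ j ℕ.+ t ℕ.* p ≡ suc (toℕ i)
CycSucc-unwrap (inj₁ j≡1+i) = 0 , trans (ℕ.+-identityʳ _) j≡1+i
CycSucc-unwrap {p} {i} {j} (inj₂ (j≡0 , 1+i≡p)) = 1 , (begin
  toℕ j ℕ.+ 1 ℕ.* p ≡⟨ cong (ℕ._+ 1 ℕ.* p) j≡0 ⟩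
  1 ℕ.* p           ≡⟨ ℕ.*-identityˡ p ⟩
  p                 ≡⟨ 1+i≡p ⟨
  suc (toℕ i)       ∎)
  where open ≡-Reasoning

ClosedWalk : {A : Set} → (A → A → Set) → (k : ℕ) → (Fin k → A) → Set
ClosedWalk _⇒_ k v = ∀ i j → CycSucc i j → v i ⇒ v j

module _ {A : Set} {_⇒_ : A → A → Set} {n : ℕ} {v : Fin (suc n) → A}
         (walk : ClosedWalk _⇒_ (suc n) v) where

  closedWalk-invariant : {P : A → Set} → (∀ {x y} → x ⇒ y → P x → P y) →
                         ∀ {i} → P (v i) → ∀ j → P (v j)
  closedWalk-invariant {P} preserves {i} Pvᵢ j =
    onwards (preserves (walk _ _ (CycSucc-fromℕ-zero n)) (onwards Pvᵢ (Fin.≤fromℕ i))) ℕ.z≤n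
    where
    onwards : ∀ {i} → P (v i) → ∀ {j} → i Fin.≤ j → P (v j)
    onwards Pvᵢ = <-weakInduction-startingFrom (P ∘ v) Pvᵢ
                    (λ j → preserves (walk _ _ (CycSucc-inject₁-suc j)))

¬closedWalk-< : ∀ {n} (g : Fin (suc n) → ℕ) → ¬ ClosedWalk ℕ._<_ (suc n) g
¬closedWalk-< {n} g walk =
  ℕ.<-irrefl refl (ℕ.<-≤-trans (walk _ _ (CycSucc-fromℕ-zero n)) (g₀≤ (fromℕ n)))
  where
  g₀≤ : ∀ j → g zero ℕ.≤ g j
  g₀≤ = closedWalk-invariant walk {P = g zero ℕ.≤_}
          (λ x<y g₀≤x → ℕ.≤-trans g₀≤x (ℕ.<⇒≤ x<y)) ℕ.≤-refl

unwrap-step : ∀ {p} a {b c} → (∃ λ s → a ℕ.+ s ℕ.* p ≡ suc b) → (∃ λ t → b ℕ.+ t ℕ.* p ≡ c) →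
              ∃ λ u → a ℕ.+ u ℕ.* p ≡ suc c
unwrap-step {p} a {b} {c} (s , a-step) (t , b-steps) = s ℕ.+ t , (begin
  a ℕ.+ (s ℕ.+ t) ℕ.* p           ≡⟨ cong (a ℕ.+_) (ℕ.*-distribʳ-+ p s t) ⟩
  a ℕ.+ (s ℕ.* p ℕ.+ t ℕ.* p)     ≡⟨ ℕ.+-assoc a _ _ ⟨
  a ℕ.+ s ℕ.* p ℕ.+ t ℕ.* p       ≡⟨ cong (ℕ._+ t ℕ.* p) a-step ⟩
  suc (b ℕ.+ t ℕ.* p)             ≡⟨ cong suc b-steps ⟩
  suc c                           ∎)
  where open ≡-Reasoning

-- Unwrapping the walk into ℕ: its j-th vertex is toℕ (g zero) + j up to a
-- multiple of p, so the closing arc makes k itself a multiple of p.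
closedWalk-CycSucc⇒∣ : ∀ {k p} (g : Fin k → Fin p) → ClosedWalk CycSucc k g → p ∣ k
closedWalk-CycSucc⇒∣ {zero} {p} _ _ = p ∣0
closedWalk-CycSucc⇒∣ {suc n} {p} g walk =
  multiple (unwrap-step g₀ (CycSucc-unwrap (walk _ _ (CycSucc-fromℕ-zero n))) (unwrapped (fromℕ n)))
  where
  g₀ : ℕ
  g₀ = toℕ (g zero)
  Unwrapped : Fin (suc n) → Set
  Unwrapped j = ∃ λ t → toℕ (g j) ℕ.+ t ℕ.* p ≡ toℕ j ℕ.+ g₀
  step : ∀ j → Unwrapped (inject₁ j) → Unwrapped (suc j)
  step j (t , g-steps) =
    unwrap-step (toℕ (g (suc j))) (CycSucc-unwrap (walk _ _ (CycSucc-inject₁-suc j)))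
      (t , trans g-steps (cong (ℕ._+ g₀) (Fin.toℕ-inject₁ j)))
  unwrapped : ∀ j → Unwrapped j
  unwrapped = <-weakInduction Unwrapped (0 , ℕ.+-identityʳ _) step
  multiple : (∃ λ u → g₀ ℕ.+ u ℕ.* p ≡ suc (toℕ (fromℕ n) ℕ.+ g₀)) → p ∣ suc n
  multiple (u , around) = divides u (sym (ℕ.+-cancelˡ-≡ g₀ _ _ (begin
    g₀ ℕ.+ u ℕ.* p              ≡⟨ around ⟩
    suc (toℕ (fromℕ n) ℕ.+ g₀)  ≡⟨ cong (λ l → suc l ℕ.+ g₀) (Fin.toℕ-fromℕ n) ⟩
    suc n ℕ.+ g₀                ≡⟨ ℕ.+-comm (suc n) g₀ ⟩
    g₀ ℕ.+ suc n                ∎)))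
    where open ≡-Reasoning

module _ {N d : ℕ} (f : Fin N → Fin N → Fin d) where

  open Inverse Fin.2↔Bool using (to; from; strictlyInverseˡ)

  ColourAbove : Fin N → Fin d → Set
  ColourAbove i x = ∃ λ j → i Fin.< j × f i j ≡ x

  colourAboveᵇ : Fin N → Fin d → Bool
  colourAboveᵇ i x = isYes (Fin.any? λ j → i Fin.<? j ×-dec f i j Fin.≟ x)

  coloursAbove : Fin N → Fin (2 ^ d)
  coloursAbove i = funToFin (from ∘ colourAboveᵇ i)

  finToFun-coloursAbove : ∀ i x → to (finToFun (coloursAbove i) x) ≡ colourAboveᵇ i x
  finToFun-coloursAbove i x =
    trans (cong to (Fin.finToFun-funToFin _ x)) (strictlyInverseˡ (colourAboveᵇ i x))

  coloursAbove-≡⇒ColourAbove : ∀ {i i′ x} → coloursAbove i ≡ coloursAbove i′ →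
                               ColourAbove i x → ColourAbove i′ x
  coloursAbove-≡⇒ColourAbove {i} {i′} {x} same above =
    toWitness (subst T same-colour (fromWitness above))
    where
    same-colour : colourAboveᵇ i x ≡ colourAboveᵇ i′ x
    same-colour = begin
      colourAboveᵇ i x                         ≡⟨ finToFun-coloursAbove i x ⟨
      to (finToFun (coloursAbove i) x)        ≡⟨ cong (λ c → to (finToFun c x)) same ⟩
      to (finToFun (coloursAbove i′) x)       ≡⟨ finToFun-coloursAbove i′ x ⟩
      colourAboveᵇ i′ x                        ∎
      where open ≡-Reasoning

  shiftGraph-monochromatic : 2 ^ d ℕ.< N →
                             ∃₂ λ i j → ∃ λ l → i Fin.< j × j Fin.< l × f i j ≡ f j l
  shiftGraph-monochromatic 2^d<N with Fin.pigeonhole 2^d<N coloursAbove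
  ... | i , j , i<j , same with coloursAbove-≡⇒ColourAbove same (j , i<j , refl)
  ... | l , j<l , fjl≡fij = i , j , l , i<j , j<l , sym fjl≡fij

MonochromaticArc : {V : Set} → (V → V → Set) → ∀ {d} → (V → Fin d) → Set
MonochromaticArc _⇒_ f = ∃₂ λ x y → x ⇒ y × f x ≡ f y

module RelationDigraph {V : Set} {m : ℕ} (vertices : Fin m ↔ V)
         {_⇒_ : V → V → Set} (_⇒?_ : Decidable _⇒_) (⇒-irrefl : ∀ x → ¬ x ⇒ x) where

  open Inverse vertices using ()
    renaming (to to decode; from to encode; strictlyInverseˡ to decode-encode)

  digraph : Digraph m
  digraph = record
    { arc      = λ u w → isYes (decode u ⇒? decode w)
    ; loopless = λ u → Equivalence.to T-not-≡ (fromWitnessFalse (⇒-irrefl (decode u)))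
    }

  arc⇒ : ∀ {u w} → Arc digraph u w → decode u ⇒ decode w
  arc⇒ = toWitness

  ⇒arc : ∀ {u y} → decode u ⇒ y → Arc digraph u (encode y)
  ⇒arc {u} {y} u⇒y = fromWitness (subst (decode u ⇒_) (sym (decode-encode y)) u⇒y)

  encode-injective : Injective _≡_ _≡_ encode
  encode-injective {x} {y} same =
    trans (sym (decode-encode x)) (trans (cong decode same) (decode-encode y))

  chromaticAtLeast : ∀ {c} → (∀ {d} → d ℕ.< c → (f : V → Fin d) → MonochromaticArc _⇒_ f) →
                     ChromaticAtLeast digraph c
  chromaticAtLeast monochromatic d d<c (f , proper) with monochromatic d<c (f ∘ encode)
  ... | x , y , x⇒y , same = proper (encode x) (encode y)
                               (⇒arc (subst (_⇒ y) (sym (decode-encode x)) x⇒y)) same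

  outdeg-≥ : ∀ {t} → (∀ x → Σ (Fin t → V) λ g → Injective _≡_ _≡_ g × (∀ y → x ⇒ g y)) →
             ∀ u → t ℕ.≤ outdeg digraph u
  outdeg-≥ outNeighbours u with outNeighbours (decode u)
  ... | g , g-injective , u⇒g =
    injective⇒≤-length-filterᵇ (arc digraph u) (encode ∘ g)
      (g-injective ∘ encode-injective) (⇒arc ∘ u⇒g)

  ¬hasDirectedCycle : ∀ {k} → (∀ v → ¬ ClosedWalk _⇒_ k v) → ¬ HasDirectedCycle k digraph
  ¬hasDirectedCycle acyclic (v , _ , cycle) = acyclic (decode ∘ v) (λ i j i→j → arc⇒ (cycle i j i→j))

module Construction (k N : ℕ) where

  Vertex : Set
  Vertex = (Fin N × Fin N) ⊎ (Fin (suc (suc k)) × Fin (N ℕ.* N))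

  vertices : Fin (suc (suc (suc k)) ℕ.* (N ℕ.* N)) ↔ Vertex
  vertices = ↔-trans Fin.+↔⊎ (Fin.*↔× ⊎-↔ Fin.*↔×)

  data _⇒_ : Vertex → Vertex → Set where
    shift : ∀ {i j l} → i Fin.< j → j Fin.< l → inj₁ (i , j) ⇒ inj₁ (j , l)
    enter : ∀ {s y} → inj₁ s ⇒ inj₂ (zero , y)
    round : ∀ {q r x y} → CycSucc q r → inj₂ (q , x) ⇒ inj₂ (r , y)

  _⇒?_ : Decidable _⇒_
  inj₁ (i , j) ⇒? inj₁ (j′ , l) with j Fin.≟ j′
  ... | yes refl = map′ (uncurry shift) (λ { (shift i<j j<l) → i<j , j<l })
                        (i Fin.<? j ×-dec j Fin.<? l)
  ... | no j≢j′ = no λ { (shift _ _) → j≢j′ refl }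
  inj₁ _ ⇒? inj₂ (zero , _) = yes enter
  inj₁ _ ⇒? inj₂ (suc _ , _) = no λ ()
  inj₂ _ ⇒? inj₁ _ = no λ ()
  inj₂ (q , _) ⇒? inj₂ (r , _) = map′ round (λ { (round q→r) → q→r }) (CycSucc? q r)

  ⇒-irrefl : ∀ x → ¬ x ⇒ x
  ⇒-irrefl _ (shift i<i _) = Fin.<-irrefl refl i<i
  ⇒-irrefl _ (round q→q) = CycSucc-irrefl _ q→q

  open RelationDigraph vertices _⇒?_ ⇒-irrefl public

  InBlowUp : Vertex → Set
  InBlowUp (inj₁ _) = ⊥
  InBlowUp (inj₂ _) = ⊤

  inBlowUp? : ∀ x → Dec (InBlowUp x)
  inBlowUp? (inj₁ _) = no λ ()
  inBlowUp? (inj₂ _) = yes tt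

  -- part is junk on the shift graph, and level on the blow-up.
  part : Vertex → Fin (suc (suc k))
  part (inj₁ _) = zero
  part (inj₂ (q , _)) = q

  level : Vertex → ℕ
  level (inj₁ (i , _)) = toℕ i
  level (inj₂ _) = 0

  ⇒-InBlowUp : ∀ {x y} → x ⇒ y → InBlowUp x → InBlowUp y
  ⇒-InBlowUp enter _ = tt
  ⇒-InBlowUp (round _) _ = tt

  ⇒-part : ∀ {x y} → x ⇒ y → InBlowUp x → CycSucc (part x) (part y)
  ⇒-part (round q→r) _ = q→r

  ⇒-level : ∀ {x y} → x ⇒ y → ¬ InBlowUp y → level x ℕ.< level y
  ⇒-level (shift i<j _) _ = i<j
  ⇒-level enter outside = ⊥-elim (outside tt)
  ⇒-level (round _) outside = ⊥-elim (outside tt)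

  ¬closedWalk : ∀ v → ¬ ClosedWalk _⇒_ (suc k) v
  ¬closedWalk v walk with inBlowUp? (v zero)
  ... | yes inside = ℕ.<-irrefl refl (∣⇒≤ (closedWalk-CycSucc⇒∣ (part ∘ v) cyclic))
    where
    cyclic : ClosedWalk CycSucc (suc k) (part ∘ v)
    cyclic i j i→j = ⇒-part (walk i j i→j) (closedWalk-invariant walk {P = InBlowUp} ⇒-InBlowUp inside i)
  ... | no outside = ¬closedWalk-< (level ∘ v) increasing
    where
    outside-everywhere : ∀ j → ¬ InBlowUp (v j)
    outside-everywhere j inside = outside (closedWalk-invariant walk {P = InBlowUp} ⇒-InBlowUp inside zero)
    increasing : ClosedWalk ℕ._<_ (suc k) (level ∘ v)
    increasing i j i→j = ⇒-level (walk i j i→j) (outside-everywhere j)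

  ⇒-wholePart : ∀ x → ∃ λ r → ∀ y → x ⇒ inj₂ (r , y)
  ⇒-wholePart (inj₁ _) = zero , λ _ → enter
  ⇒-wholePart (inj₂ (q , _)) with cyclicSuccessor q
  ... | r , q→r = r , λ _ → round q→r

  outNeighbours : ∀ x → Σ (Fin (N ℕ.* N) → Vertex) λ g → Injective _≡_ _≡_ g × (∀ y → x ⇒ g y)
  outNeighbours x with ⇒-wholePart x
  ... | r , x⇒r = (λ y → inj₂ (r , y)) , (λ same → ,-injectiveʳ (inj₂-injective same)) , x⇒r

  monochromaticArc : ∀ {d} → 2 ^ d ℕ.< N → (f : Vertex → Fin d) → MonochromaticArc _⇒_ f
  monochromaticArc 2^d<N f with shiftGraph-monochromatic (λ i j → f (inj₁ (i , j))) 2^d<N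
  ... | i , j , l , i<j , j<l , same = inj₁ (i , j) , inj₁ (j , l) , shift i<j j<l , same

-- mkℚ takes the denominator minus one: unitFraction n is 1 / (n + 1).
unitFraction : ℕ → ℚ
unitFraction n = mkℚ (+ 1) n (Coprime.1-coprimeTo (suc n))

fromℕ/1 : ℕ → ℚ
fromℕ/1 n = mkℚ (+ n) 0 (Coprime.sym (Coprime.1-coprimeTo n))

/1≡fromℕ/1 : ∀ n → (+ n) / 1 ≡ fromℕ/1 n
/1≡fromℕ/1 n = normalize-coprime _

unitFraction-*-≤ : ∀ n T d → T ℕ.≤ d → unitFraction n * ((+ (suc n ℕ.* T)) / 1) ≤ (+ d) / 1
unitFraction-*-≤ n T d T≤d rewrite /1≡fromℕ/1 (suc n ℕ.* T) | /1≡fromℕ/1 d =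
  toℚᵘ-cancel-≤ (ℚᵘ.≤-respˡ-≃ (ℚᵘ.≃-sym (toℚᵘ-homo-* (unitFraction n) (fromℕ/1 (suc n ℕ.* T))))
    (ℚᵘ.*≤* (subst₂ ℤ._≤_ lhs rhs (ℤ.+≤+ (ℕ.*-monoʳ-≤ (suc n) T≤d)))))
  where
  product : ℚᵘ.ℚᵘ
  product = toℚᵘ (unitFraction n) ℚᵘ.* toℚᵘ (fromℕ/1 (suc n ℕ.* T))
  lhs : + (suc n ℕ.* T) ≡ ↥ product ℤ.* ↧ toℚᵘ (fromℕ/1 d)
  lhs = sym (trans (ℤ.*-identityʳ _) (ℤ.*-identityˡ _))
  rhs : + (suc n ℕ.* d) ≡ ↥ toℚᵘ (fromℕ/1 d) ℤ.* ↧ product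
  rhs = trans (cong +_ (trans (ℕ.*-comm (suc n) d) (cong (d ℕ.*_) (sym (ℕ.*-identityʳ (suc n))))))
              (ℤ.pos-* d _)

theorem3p1 : (k : ℕ) → k ≥ 2 →
    Σ ℚ λ ε → 0ℚ < ε ×
      ((n c : ℕ) → Σ ℕ λ m → Σ (Digraph m) λ D →
        m ≥ n × ChromaticAtLeast D c ×
        (∀ v → ε * ((+ m) / 1) ≤ (+ outdeg D v) / 1) ×
        ¬ HasDirectedCycle k D)
-- k ≥ 2 only rules out k = 0, for which the empty family is a 0-cycle.
theorem3p1 zero ()
theorem3p1 (suc k) _ = unitFraction (suc (suc k)) , positive⁻¹ _ , λ n c →
  let N = suc (2 ^ c ℕ.+ n)
      open Construction k N
      2^c<N : 2 ^ c ℕ.< N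
      2^c<N = ℕ.s≤s (ℕ.m≤m+n (2 ^ c) n)
      n≤m : n ℕ.≤ suc (suc (suc k)) ℕ.* (N ℕ.* N)
      n≤m = ℕ.≤-trans (ℕ.m≤n+m n (suc (2 ^ c)))
              (ℕ.≤-trans (ℕ.m≤m*n N N) (ℕ.m≤n*m (N ℕ.* N) (suc (suc (suc k)))))
  in _ , digraph , n≤m ,
     chromaticAtLeast (λ d<c → monochromaticArc (ℕ.≤-<-trans (ℕ.^-monoʳ-≤ 2 (ℕ.<⇒≤ d<c)) 2^c<N)) ,
     (λ u → unitFraction-*-≤ (suc (suc k)) (N ℕ.* N) _ (outdeg-≥ outNeighbours u)) ,
     ¬hasDirectedCycle ¬closedWalk
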